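{- Let $G \in \mathcal{C}$, let $S$ be a minimal separator of $G$ with distinct full components $L, R$, and let $Z, Z', f, g, W, Z_L, Z_R$ be as described in the context (with $|Z|,|Z'|\ge 2$). Let $I$ be an independent set of $G$. If $i_1,i_2 \in I$ and $N(i_1)\cap W$ and $N(i_2)\cap W$ are both $L$-ambiguous profiles, then $N(i_1)\cap Z_R$ and $N(i_2)\cap Z_R$ are comparable under inclusion. Similarly, if $i_1,i_2\in I$ and $N(i_1)\cap W$ and $N(i_2)\cap W$ are both $R$-ambiguous profiles, then $N(i_1)\cap Z_L$ and $N(i_2)\cap Z_L$ are comparable under inclusion.
   Context: $\mathcal{C}$ is the class of graphs with no induced cycle of length at least $6$ and no induced extended $C_5$ (a five-vertex induced cycle plus a vertex adjacent to exactly one or exactly two consecutive of its vertices). $N(X)$ is the open neighborhood. A minimal separator $S$ is a set such that $G-S$ has at least two components $D$ with $N(D)=S$ (full components). Setting: $Z \subseteq L$ is a clique with $S \subseteq N(Z)$ and $(N(z)\cap S)\setminus N(Z\setminus\{z\}) \ne \emptyset$ for all $z \in Z$; $Z' \subseteq R$ is a clique with the analogous properties. For $z \in Z$, $f(z) \in (N(z)\cap S)\setminus N(Z\setminus\{z\})$ and $g(z)$ is a neighbor of $f(z)$ in $R$; for $z \in Z'$, $f(z)\in (N(z)\cap S)\setminus N(Z'\setminus\{z\})$ and $g(z)$ is a neighbor of $f(z)$ in $L$. Choose distinct $a_1,a_2 \in Z$ and put $b_i=f(a_i)$, $r_i=g(a_i)$; choose distinct $d_1,d_2 \in Z'$ and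 put $c_i=f(d_i)$, $l_i=g(d_i)$ ($i=1,2$). Let $W=\{a_1,a_2,b_1,b_2,r_1,r_2,c_1,c_2,d_1,d_2,l_1,l_2\}$. A profile is a subset $T\subseteq W$ meeting each of $\{a_1,b_1,r_1\},\{a_2,b_2,r_2\},\{c_1,d_1,l_1\},\{c_2,d_2,l_2\}$. A profile $T$ is $L$-ambiguous if $T\subseteq\{a_1,a_2,b_1,b_2,c_1,c_2,l_1,l_2\}$ and $R$-ambiguous if $T \subseteq \{b_1,b_2,c_1,c_2,d_1,d_2,r_1,r_2\}$. $Z_R$ is the set of vertices complete to $\{d_1,d_2\}$ and anticomplete to $\{c_1,c_2,l_1,l_2\}$; $Z_L$ is the set of vertices complete to $\{a_1,a_2\}$ and anticomplete to $\{b_1,b_2,r_1,r_2\}$. -}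

module Defs where

open import Data.Nat using (ℕ; suc; _≤_; _%_)
open import Data.Fin using (Fin; toℕ)
open import Data.Fin.Subset using (Subset; _∈_; _∉_)
open import Data.Bool using (Bool; true; false)
open import Data.List using (List; []; _∷_)
open import Data.List.Membership.Propositional using () renaming (_∈_ to _∈ₗ_)
open import Data.Product using (Σ; ∃; ∃-syntax; _×_; _,_)
open import Data.Sum using (_⊎_)
open import Data.Empty using (⊥)
open import Relation.Binary.PropositionalEquality using (_≡_; _≢_)
open import Relation.Nullary using (¬_)
open import Function.Bundles using (_⇔_)
open import Function.Definitions using (Injective)

record Graph (n : ℕ) : Set where
  field
    adj    : Fin n → Fin n → Bool
    sym    : ∀ u v → adj u v ≡ adj v u
    irrefl : ∀ v → adj v v ≡ false

module _ {n : ℕ} (G : Graph n) where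
  open Graph G

  Edge : Fin n → Fin n → Set
  Edge u v = adj u v ≡ true

  CycAdj : {m : ℕ} → Fin (suc m) → Fin (suc m) → Set
  CycAdj {m} i j = (suc (toℕ i) % suc m ≡ toℕ j) ⊎ (suc (toℕ j) % suc m ≡ toℕ i)

  -- an induced cycle of length (suc m), given by its vertices in cyclic order
  InducedCycle : (m : ℕ) → (Fin (suc m) → Fin n) → Set
  InducedCycle m c = Injective _≡_ _≡_ c × (∀ i j → Edge (c i) (c j) ⇔ CycAdj i j)

  ExtendedC5 : (Fin 5 → Fin n) → Fin n → Set
  ExtendedC5 c x =
    InducedCycle 4 c × (∀ i → x ≢ c i) ×
    (∃[ i ] ((∀ j → Edge x (c j) ⇔ (j ≡ i))
           ⊎ (∀ j → Edge x (c j) ⇔ (j ≡ i ⊎ suc (toℕ i) % 5 ≡ toℕ j))))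

  -- G ∈ 𝒞: no induced cycle of length ≥ 6 and no induced extended C5
  InClassC : Set
  InClassC = (∀ m → 5 ≤ m → ∀ c → ¬ InducedCycle m c)
           × (∀ c x → ¬ ExtendedC5 c x)

  _∈N_ : Fin n → Subset n → Set
  v ∈N X = v ∉ X × ∃[ u ] (u ∈ X × Edge u v)

  data Path (X : Subset n) : Fin n → Fin n → Set where
    here : ∀ {u} → u ∈ X → Path X u u
    step : ∀ {u w v} → u ∈ X → Edge u w → Path X w v → Path X u v

  IsComponent : Subset n → Subset n → Set
  IsComponent S D =
    (∃[ v ] v ∈ D) ×
    (∀ v → v ∈ D → v ∉ S) ×
    (∀ u v → u ∈ D → v ∈ D → Path D u v) ×
    (∀ u v → u ∈ D → v ∉ S → Edge u v → v ∈ D)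

  IsFullComponent : Subset n → Subset n → Set
  IsFullComponent S D = IsComponent S D × (∀ v → (v ∈ S) ⇔ (v ∈N D))

  IsMinimalSeparator : Subset n → Set
  IsMinimalSeparator S = ∃[ D₁ ] ∃[ D₂ ] (D₁ ≢ D₂ × IsFullComponent S D₁ × IsFullComponent S D₂)

  IsClique : Subset n → Set
  IsClique X = ∀ u v → u ∈ X → v ∈ X → u ≢ v → Edge u v

  IsIndependent : Subset n → Set
  IsIndependent X = ∀ u v → u ∈ X → v ∈ X → ¬ Edge u v

  -- N(X \ {z}) for z ∈ X, with X disjoint from the vertex in question:
  -- v has a neighbour in X other than z
  AdjToOther : Subset n → Fin n → Fin n → Set
  AdjToOther X z v = ∃[ z' ] (z' ∈ X × z' ≢ z × Edge z' v)

  GoodClique : Subset n → Subset n → Subset n → Set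
  GoodClique S D Z =
    (∀ z → z ∈ Z → z ∈ D) × IsClique Z ×
    (∀ s → s ∈ S → s ∈N Z) ×
    (∀ z → z ∈ Z → ∃[ s ] (s ∈ S × Edge z s × ¬ AdjToOther Z z s))

  GoodChoice : Subset n → Subset n → Subset n → (Fin n → Fin n) → (Fin n → Fin n) → Set
  GoodChoice S D' Z f g =
    ∀ z → z ∈ Z →
      (f z ∈ S × Edge z (f z) × ¬ AdjToOther Z z (f z)) × (g z ∈ D' × Edge (f z) (g z))

  IsProfile : List (Fin n) → List (List (Fin n)) → (Fin n → Set) → Set
  IsProfile W triples T =
    (∀ v → T v → v ∈ₗ W) × (∀ t → t ∈ₗ triples → ∃[ v ] (v ∈ₗ t × T v))

  -- T is a profile contained in the list A (used for L-/R-ambiguity)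
  AmbiguousProfile : List (Fin n) → List (List (Fin n)) → List (Fin n) → (Fin n → Set) → Set
  AmbiguousProfile W triples A T = IsProfile W triples T × (∀ v → T v → v ∈ₗ A)

  NbhdIn : List (Fin n) → Fin n → Fin n → Set
  NbhdIn W i v = v ∈ₗ W × Edge i v

  CompleteAnti : List (Fin n) → List (Fin n) → Fin n → Set
  CompleteAnti P Q v = (∀ p → p ∈ₗ P → Edge v p) × (∀ q → q ∈ₗ Q → ¬ Edge v q)

  Comparable : (Fin n → Set) → Fin n → Fin n → Set
  Comparable Y i₁ i₂ =
    (∀ v → Y v → Edge i₁ v → Edge i₂ v) ⊎ (∀ v → Y v → Edge i₂ v → Edge i₁ v)

-- Both halves are the same argument on the two sides of S. On the side of the clique Z' ⊆ R,
-- the edge x y = f d₁ g d₁ is missed by d₂, and an L-ambiguous vertex misses d₂ but sees x or y.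
-- If the neighbourhoods of i₁, i₂ ∈ I were incomparable on the vertices seeing d₂ but neither x
-- nor y (a superset of Z_R), private neighbours z₁ of i₁ and z₂ of i₂ there would give an induced path
-- i₁ z₁ (d₂) z₂ i₂, which the edge x y closes into an induced C₆ or C₇, or into a C₅ with d₂
-- hanging on z₁ z₂ — all excluded in 𝒞.

module Submission where

open import Defs
open import Data.Nat using (ℕ; zero; suc; _%_; _≡ᵇ_; _≤_)
open import Data.Nat.Properties using (≡ᵇ⇒≡; ≡⇒≡ᵇ; ≤-refl; n≤1+n)
open import Data.Fin using (Fin; zero; suc; toℕ; _≟_)
open import Data.Fin.Properties using (all?; any?)
open import Data.Fin.Subset using (Subset; _∈_; _∉_; _⊆_)
open import Data.Fin.Subset.Properties using (⊆-antisym)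
open import Data.Bool using (Bool; true; false; _∨_)
open import Data.Bool.Properties using (∨-comm; ¬-not; T-≡; T-∨) renaming (_≟_ to _≟ᵇ_)
open import Data.Vec using (Vec; []; _∷_; lookup)
open import Data.List using (List; []; _∷_)
open import Data.List.Membership.Propositional using () renaming (_∈_ to _∈ₗ_)
open import Data.List.Relation.Unary.Any using (here; there)
open import Data.List.Relation.Unary.All as All using (All; []; _∷_)
open import Data.Product using (∃-syntax; _×_; _,_; proj₁; proj₂)
open import Data.Sum using (_⊎_; inj₁; inj₂; [_,_]; swap) renaming (map to map-⊎)
open import Data.Unit using (⊤)
open import Data.Empty using (⊥; ⊥-elim)
open import Function using (_∘_; id)
open import Function.Bundles using (_⇔_; mk⇔; Equivalence)
open import Function.Definitions using (Injective)
open import Relation.Binary.PropositionalEquality using (_≡_; _≢_; refl; sym; trans; ≢-sym)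
open import Relation.Nullary using (¬_; Dec; yes; no)
open import Relation.Nullary.Decidable using (from-yes; _×-dec_; _⊎-dec_; ¬?; decidable-stable)

cycleAdj : {m : ℕ} → Fin (suc m) → Fin (suc m) → Bool
cycleAdj {m} i j = (suc (toℕ i) % suc m ≡ᵇ toℕ j) ∨ (suc (toℕ j) % suc m ≡ᵇ toℕ i)

cycleAdj-sym : ∀ {m} (i j : Fin (suc m)) → cycleAdj i j ≡ cycleAdj j i
cycleAdj-sym {m} i j = ∨-comm (suc (toℕ i) % suc m ≡ᵇ toℕ j) _

CycleLoopless : ℕ → Set
CycleLoopless m = (i : Fin (suc m)) → cycleAdj i i ≡ false

CycleRowsDistinct : ℕ → Set
CycleRowsDistinct m = (i j : Fin (suc m)) → i ≡ j ⊎ ∃[ k ] cycleAdj i k ≢ cycleAdj j k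

cycleLoopless? : ∀ m → Dec (CycleLoopless m)
cycleLoopless? m = all? λ i → cycleAdj i i ≟ᵇ false

cycleRowsDistinct? : ∀ m → Dec (CycleRowsDistinct m)
cycleRowsDistinct? m =
  all? λ i → all? λ j → (i ≟ j) ⊎-dec any? λ k → ¬? (cycleAdj i k ≟ᵇ cycleAdj j k)

hangsOn₁₂ : Fin 5 → Bool
hangsOn₁₂ = lookup (false ∷ true ∷ true ∷ false ∷ false ∷ [])

hangsOn₁₂-true⇒ : ∀ j → hangsOn₁₂ j ≡ true → j ≡ suc zero ⊎ 2 ≡ toℕ j
hangsOn₁₂-true⇒ zero                         ()
hangsOn₁₂-true⇒ (suc zero)                   _ = inj₁ refl
hangsOn₁₂-true⇒ (suc (suc zero))             _ = inj₂ refl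
hangsOn₁₂-true⇒ (suc (suc (suc zero)))       ()
hangsOn₁₂-true⇒ (suc (suc (suc (suc zero)))) ()

⇒hangsOn₁₂-true : ∀ j → j ≡ suc zero ⊎ 2 ≡ toℕ j → hangsOn₁₂ j ≡ true
⇒hangsOn₁₂-true zero                         (inj₁ ())
⇒hangsOn₁₂-true zero                         (inj₂ ())
⇒hangsOn₁₂-true (suc zero)                   _ = refl
⇒hangsOn₁₂-true (suc (suc zero))             _ = refl
⇒hangsOn₁₂-true (suc (suc (suc zero)))       (inj₁ ())
⇒hangsOn₁₂-true (suc (suc (suc zero)))       (inj₂ ())
⇒hangsOn₁₂-true (suc (suc (suc (suc zero)))) (inj₁ ())
⇒hangsOn₁₂-true (suc (suc (suc (suc zero)))) (inj₂ ())

hangsOn₁₂-off-cycle? : Dec (∀ (i : Fin 5) → ∃[ k ] hangsOn₁₂ k ≢ cycleAdj i k)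
hangsOn₁₂-off-cycle? = all? λ i → any? λ k → ¬? (hangsOn₁₂ k ≟ᵇ cycleAdj i k)

module _ {n : ℕ} (G : Graph n) where
  open Graph G using (adj; irrefl) renaming (sym to adj-comm)

  adj-sym : ∀ {u v b} → adj u v ≡ b → adj v u ≡ b
  adj-sym {u} {v} = trans (adj-comm v u)

  Row : {k : ℕ} → Fin n → (Fin k → Fin n) → (Fin k → Bool) → Set
  Row {zero}  v c r = ⊤
  Row {suc k} v c r = adj v (c zero) ≡ r zero × Row v (c ∘ suc) (r ∘ suc)

  -- The adjacencies among c 0, …, c (k-1) prescribed by M, listed above the diagonal only.
  Triangle : {k : ℕ} → (Fin k → Fin n) → (Fin k → Fin k → Bool) → Set
  Triangle {zero}  c M = ⊤
  Triangle {suc k} c M =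
    Row (c zero) (c ∘ suc) (M zero ∘ suc) × Triangle (c ∘ suc) (λ i j → M (suc i) (suc j))

  row-lookup : ∀ {k v c r} → Row {k} v c r → ∀ j → adj v (c j) ≡ r j
  row-lookup (e , _)   zero    = e
  row-lookup (_ , row) (suc j) = row-lookup row j

  triangle-lookup : ∀ {k c M} → (∀ i j → M i j ≡ M j i) → (∀ i → M i i ≡ false) →
                    Triangle {k} c M → ∀ i j → adj (c i) (c j) ≡ M i j
  triangle-lookup M-sym M-loopless _         zero    zero    = trans (irrefl _) (sym (M-loopless zero))
  triangle-lookup M-sym M-loopless (row , _) zero    (suc j) = row-lookup row j
  triangle-lookup M-sym M-loopless (row , _) (suc i) zero    =
    adj-sym (trans (row-lookup row i) (M-sym zero (suc i)))
  triangle-lookup M-sym M-loopless (_ , tri) (suc i) (suc j) =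
    triangle-lookup (λ i j → M-sym (suc i) (suc j)) (M-loopless ∘ suc) tri i j

  equal-vertices-equal-rows : ∀ {u u' w b b'} → u ≡ u' → adj u w ≡ b → adj u' w ≡ b' → b ≡ b'
  equal-vertices-equal-rows refl e e' = trans (sym e) e'

  cycleAdj⇔CycAdj : ∀ {m} (i j : Fin (suc m)) → cycleAdj i j ≡ true ⇔ CycAdj G i j
  cycleAdj⇔CycAdj i j = mk⇔
    (map-⊎ (≡ᵇ⇒≡ _ _) (≡ᵇ⇒≡ _ _) ∘ Equivalence.to T-∨ ∘ Equivalence.from T-≡)
    (Equivalence.to T-≡ ∘ Equivalence.from T-∨ ∘ map-⊎ (≡⇒≡ᵇ _ _) (≡⇒≡ᵇ _ _))

  triangle⇒InducedCycle : ∀ {m} {c : Fin (suc m) → Fin n} → CycleLoopless m → CycleRowsDistinct m →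
                          Triangle c cycleAdj → InducedCycle G m c
  triangle⇒InducedCycle {m} {c} loopless distinct tri = injective , λ i j →
    mk⇔ (Equivalence.to (cycleAdj⇔CycAdj i j) ∘ trans (sym (table i j)))
        (trans (table i j) ∘ Equivalence.from (cycleAdj⇔CycAdj i j))
    where
    table : ∀ i j → adj (c i) (c j) ≡ cycleAdj i j
    table = triangle-lookup cycleAdj-sym loopless tri
    injective : Injective _≡_ _≡_ c
    injective {i} {j} cᵢ≡cⱼ with distinct i j
    ... | inj₁ i≡j           = i≡j
    ... | inj₂ (k , rows≢) = ⊥-elim (rows≢ (equal-vertices-equal-rows cᵢ≡cⱼ (table i k) (table j k)))

  no-long-induced-cycle : InClassC G → ∀ {m} → 5 ≤ m → CycleLoopless m → CycleRowsDistinct m →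
                          (c : Fin (suc m) → Fin n) → ¬ Triangle c cycleAdj
  no-long-induced-cycle (noHoles , _) 5≤m loopless distinct c =
    noHoles _ 5≤m c ∘ triangle⇒InducedCycle loopless distinct

  no-induced-C₆ : InClassC G → (vs : Vec (Fin n) 6) → ¬ Triangle (lookup vs) cycleAdj
  no-induced-C₆ cl vs = no-long-induced-cycle cl ≤-refl
    (from-yes (cycleLoopless? 5)) (from-yes (cycleRowsDistinct? 5)) (lookup vs)

  no-induced-C₇ : InClassC G → (vs : Vec (Fin n) 7) → ¬ Triangle (lookup vs) cycleAdj
  no-induced-C₇ cl vs = no-long-induced-cycle cl (n≤1+n 5)
    (from-yes (cycleLoopless? 6)) (from-yes (cycleRowsDistinct? 6)) (lookup vs)

  no-extended-C₅ : InClassC G → (vs : Vec (Fin n) 5) (x : Fin n) →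
                   Triangle (lookup vs) cycleAdj → ¬ Row x (lookup vs) hangsOn₁₂
  no-extended-C₅ (_ , noExtended) vs x tri row =
    noExtended c x (triangle⇒InducedCycle loopless distinct tri , off-cycle , suc zero , inj₂ hangs)
    where
    c : Fin 5 → Fin n
    c = lookup vs
    loopless : CycleLoopless 4
    loopless = from-yes (cycleLoopless? 4)
    distinct : CycleRowsDistinct 4
    distinct = from-yes (cycleRowsDistinct? 4)
    x-row : ∀ j → adj x (c j) ≡ hangsOn₁₂ j
    x-row = row-lookup {c = c} row
    off-cycle : ∀ i → x ≢ c i
    off-cycle i x≡cᵢ with from-yes hangsOn₁₂-off-cycle? i
    ... | k , rows≢ = rows≢ (equal-vertices-equal-rows x≡cᵢ (x-row k)
                               (triangle-lookup {c = c} cycleAdj-sym loopless tri i k))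
    hangs : ∀ j → Edge G x (c j) ⇔ (j ≡ suc zero ⊎ 2 ≡ toℕ j)
    hangs j = mk⇔ (hangsOn₁₂-true⇒ j ∘ trans (sym (x-row j)))
                  (trans (x-row j) ∘ ⇒hangsOn₁₂-true j)

  module Crossing (cl : InClassC G) {i₁ i₂ d z₁ z₂ : Fin n}
    (i₁i₂ : adj i₁ i₂ ≡ false) (i₁d : adj i₁ d ≡ false) (i₂d : adj i₂ d ≡ false)
    (z₁d : adj z₁ d ≡ true) (z₂d : adj z₂ d ≡ true)
    (i₁z₁ : adj i₁ z₁ ≡ true) (i₂z₁ : adj i₂ z₁ ≡ false)
    (i₂z₂ : adj i₂ z₂ ≡ true) (i₁z₂ : adj i₁ z₂ ≡ false) where

    Hidden : Fin n → Set
    Hidden w = adj d w ≡ false × adj z₁ w ≡ false × adj z₂ w ≡ false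

    -- The induced path from i₁ to i₂ is i₁ z₁ d z₂ i₂ or, when z₁ z₂ is an edge, i₁ z₁ z₂ i₂.
    no-hidden-common-neighbour : ∀ {w} → adj i₁ w ≡ true → adj i₂ w ≡ true → ¬ Hidden w
    no-hidden-common-neighbour {w} i₁w i₂w (dw , z₁w , z₂w) with adj z₁ z₂ in z₁z₂
    ... | false = no-induced-C₆ cl (i₁ ∷ z₁ ∷ d ∷ z₂ ∷ i₂ ∷ w ∷ [])
      ( (i₁z₁ , i₁d , i₁z₂ , i₁i₂ , i₁w , _)
      , (z₁d , z₁z₂ , adj-sym i₂z₁ , z₁w , _)
      , (adj-sym z₂d , adj-sym i₂d , dw , _)
      , (adj-sym i₂z₂ , z₂w , _)
      , (i₂w , _) , _ )
    ... | true = no-extended-C₅ cl (i₁ ∷ z₁ ∷ z₂ ∷ i₂ ∷ w ∷ []) d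
      ( (i₁z₁ , i₁z₂ , i₁i₂ , i₁w , _)
      , (z₁z₂ , adj-sym i₂z₁ , z₁w , _)
      , (adj-sym i₂z₂ , z₂w , _)
      , (i₂w , _) , _ )
      (adj-sym i₁d , adj-sym z₁d , adj-sym z₂d , adj-sym i₂d , dw , _)

    no-hidden-crossing-edge : ∀ {u v} → adj u v ≡ true →
      adj i₁ u ≡ true → adj i₂ v ≡ true → adj i₁ v ≡ false → adj i₂ u ≡ false →
      Hidden u → ¬ Hidden v
    no-hidden-crossing-edge {u} {v} uv i₁u i₂v i₁v i₂u (du , z₁u , z₂u) (dv , z₁v , z₂v)
      with adj z₁ z₂ in z₁z₂
    ... | false = no-induced-C₇ cl (i₁ ∷ z₁ ∷ d ∷ z₂ ∷ i₂ ∷ v ∷ u ∷ [])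
      ( (i₁z₁ , i₁d , i₁z₂ , i₁i₂ , i₁v , i₁u , _)
      , (z₁d , z₁z₂ , adj-sym i₂z₁ , z₁v , z₁u , _)
      , (adj-sym z₂d , adj-sym i₂d , dv , du , _)
      , (adj-sym i₂z₂ , z₂v , z₂u , _)
      , (i₂v , i₂u , _)
      , (adj-sym uv , _) , _ )
    ... | true = no-induced-C₆ cl (i₁ ∷ z₁ ∷ z₂ ∷ i₂ ∷ v ∷ u ∷ [])
      ( (i₁z₁ , i₁z₂ , i₁i₂ , i₁v , i₁u , _)
      , (z₁z₂ , adj-sym i₂z₁ , z₁v , z₁u , _)
      , (adj-sym i₂z₂ , z₂v , z₂u , _)
      , (i₂v , i₂u , _)
      , (adj-sym uv , _) , _ )

    no-hidden-edge-seen-by-both : ∀ {x y} → adj x y ≡ true → Hidden x → Hidden y →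
      adj i₁ x ≡ true ⊎ adj i₁ y ≡ true → adj i₂ x ≡ true ⊎ adj i₂ y ≡ true → ⊥
    no-hidden-edge-seen-by-both xy hx hy (inj₁ i₁x) i₂sees = seen-by-i₁ xy hx hy i₁x i₂sees
      where
      seen-by-i₁ : ∀ {x y} → adj x y ≡ true → Hidden x → Hidden y →
        adj i₁ x ≡ true → adj i₂ x ≡ true ⊎ adj i₂ y ≡ true → ⊥
      seen-by-i₁ {x} {y} xy hx hy i₁x i₂sees with adj i₂ x in i₂x | adj i₁ y in i₁y
      ... | true  | _     = no-hidden-common-neighbour i₁x i₂x hx
      ... | false | true  = no-hidden-common-neighbour i₁y ([ (λ ()) , id ] i₂sees) hy
      ... | false | false = no-hidden-crossing-edge xy i₁x ([ (λ ()) , id ] i₂sees) i₁y i₂x hx hy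
    no-hidden-edge-seen-by-both xy hx hy (inj₂ i₁y) i₂sees =
      no-hidden-edge-seen-by-both (adj-sym xy) hy hx (inj₁ i₁y) (swap i₂sees)

  crossing-or-⊆ : {P : Fin n → Set} → (∀ v → Dec (P v)) → (i j : Fin n) →
    (∀ v → P v → Edge G i v → Edge G j v) ⊎ ∃[ z ] (P z × Edge G i z × adj j z ≡ false)
  crossing-or-⊆ P? i j with any? (λ z → P? z ×-dec (adj i z ≟ᵇ true) ×-dec (adj j z ≟ᵇ false))
  ... | yes crossing = inj₂ crossing
  ... | no  none     = inj₁ λ v Pv iv →
    decidable-stable (adj j v ≟ᵇ true) λ ¬jv → none (v , Pv , iv , ¬-not ¬jv)

  SeesAvoiding : Fin n → Fin n → Fin n → Fin n → Set
  SeesAvoiding d x y v = Edge G v d × ¬ Edge G v x × ¬ Edge G v y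

  seesAvoiding? : ∀ d x y v → Dec (SeesAvoiding d x y v)
  seesAvoiding? d x y v = (adj v d ≟ᵇ true) ×-dec ¬? (adj v x ≟ᵇ true) ×-dec ¬? (adj v y ≟ᵇ true)

  comparable-on-seesAvoiding : InClassC G → ∀ {x y d i₁ i₂} →
    Edge G x y → ¬ Edge G d x → ¬ Edge G d y →
    ¬ Edge G i₁ i₂ → ¬ Edge G i₁ d → ¬ Edge G i₂ d →
    Edge G i₁ x ⊎ Edge G i₁ y → Edge G i₂ x ⊎ Edge G i₂ y →
    Comparable G (SeesAvoiding d x y) i₁ i₂
  comparable-on-seesAvoiding cl {x} {y} {d} {i₁} {i₂} xy dx dy i₁i₂ i₁d i₂d i₁sees i₂sees
    with crossing-or-⊆ (seesAvoiding? d x y) i₁ i₂ | crossing-or-⊆ (seesAvoiding? d x y) i₂ i₁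
  ... | inj₁ ⊆₁₂ | _        = inj₁ ⊆₁₂
  ... | inj₂ _   | inj₁ ⊆₂₁ = inj₂ ⊆₂₁
  ... | inj₂ (z₁ , (z₁d , z₁x , z₁y) , i₁z₁ , i₂z₁) | inj₂ (z₂ , (z₂d , z₂x , z₂y) , i₂z₂ , i₁z₂) =
    ⊥-elim (Crossing.no-hidden-edge-seen-by-both cl (¬-not i₁i₂) (¬-not i₁d) (¬-not i₂d) z₁d z₂d i₁z₁ i₂z₁ i₂z₂ i₁z₂
      xy (¬-not dx , ¬-not z₁x , ¬-not z₂x) (¬-not dy , ¬-not z₁y , ¬-not z₂y) i₁sees i₂sees)

  Comparable-mono : ∀ {Y Y' : Fin n → Set} {i₁ i₂} → (∀ v → Y v → Y' v) →
                    Comparable G Y' i₁ i₂ → Comparable G Y i₁ i₂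
  Comparable-mono Y⊆Y' (inj₁ ⊆₁₂) = inj₁ λ v → ⊆₁₂ v ∘ Y⊆Y' v
  Comparable-mono Y⊆Y' (inj₂ ⊆₂₁) = inj₂ λ v → ⊆₂₁ v ∘ Y⊆Y' v

  path-start : ∀ {X u v} → Path G X u v → u ∈ X
  path-start (here u∈X)     = u∈X
  path-start (step u∈X _ _) = u∈X

  component-absorbs-path : ∀ {S D X u w} → IsComponent G S D → (∀ v → v ∈ X → v ∉ S) →
                           u ∈ D → Path G X u w → w ∈ D
  component-absorbs-path _ _ u∈D (here _) = u∈D
  component-absorbs-path comp@(_ , _ , _ , closed) X∌S u∈D (step _ e p) =
    component-absorbs-path comp X∌S (closed _ _ u∈D (X∌S _ (path-start p)) e) p

  components-disjoint : ∀ {S L R v} → L ≢ R → IsComponent G S L → IsComponent G S R →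
                        v ∈ L → v ∉ R
  components-disjoint {L = L} {R} {v} L≢R compL@(_ , L∌S , connL , _) compR@(_ , R∌S , connR , _) v∈L v∈R =
    L≢R (⊆-antisym L⊆R R⊆L)
    where
    L⊆R : L ⊆ R
    L⊆R u∈L = component-absorbs-path compR L∌S v∈R (connL _ _ v∈L u∈L)
    R⊆L : R ⊆ L
    R⊆L u∈R = component-absorbs-path compL R∌S v∈L (connR _ _ v∈R u∈R)

  components-nonadjacent : ∀ {S L R u v} → L ≢ R → IsComponent G S L → IsComponent G S R →
                           u ∈ L → v ∈ R → ¬ Edge G u v
  components-nonadjacent L≢R compL@(_ , _ , _ , closedL) compR@(_ , R∌S , _ , _) u∈L v∈R e =
    components-disjoint L≢R compL compR (closedL _ _ u∈L (R∌S _ v∈R) e) v∈R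

  module _ {S D' Z : Subset n} {f g : Fin n → Fin n} (choice : GoodChoice G S D' Z f g)
           {z : Fin n} (z∈Z : z ∈ Z) where

    choice-∈S : f z ∈ S
    choice-∈S = proj₁ (proj₁ (choice z z∈Z))

    choice-private : ¬ AdjToOther G Z z (f z)
    choice-private = proj₂ (proj₂ (proj₁ (choice z z∈Z)))

    partner-∈ : g z ∈ D'
    partner-∈ = proj₁ (proj₂ (choice z z∈Z))

    choice-partner-edge : Edge G (f z) (g z)
    choice-partner-edge = proj₂ (proj₂ (choice z z∈Z))

  module _ {W : List (Fin n)} {triples : List (List (Fin n))} {A : List (Fin n)} {D : Subset n} {i : Fin n}
           (ambiguous : AmbiguousProfile G W triples A (NbhdIn G W i)) (A∌D : All (_∉ D) A) where

    ambiguous-misses : ∀ {v} → v ∈ₗ W → v ∈ D → ¬ Edge G i v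
    ambiguous-misses v∈W v∈D e = All.lookup A∌D (proj₂ ambiguous _ (v∈W , e)) v∈D

    ambiguous-meets-outside : ∀ {t} → t ∈ₗ triples → ∃[ v ] (v ∈ₗ t × v ∉ D × Edge G i v)
    ambiguous-meets-outside t∈triples with proj₂ (proj₁ ambiguous) _ t∈triples
    ... | v , v∈t , v∈N@(_ , e) = v , v∈t , All.lookup A∌D (proj₂ ambiguous v v∈N) , e

  comparable-on-clique-side : InClassC G →
    ∀ {S D D' Z f g z₁ z₂ i₁ i₂} → D ≢ D' → IsComponent G S D → IsComponent G S D' →
    GoodClique G S D Z → GoodChoice G S D' Z f g → z₁ ∈ Z → z₂ ∈ Z → z₁ ≢ z₂ →
    ¬ Edge G i₁ i₂ → ¬ Edge G i₁ z₂ → ¬ Edge G i₂ z₂ →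
    Edge G i₁ (f z₁) ⊎ Edge G i₁ (g z₁) → Edge G i₂ (f z₁) ⊎ Edge G i₂ (g z₁) →
    Comparable G (CompleteAnti G (z₁ ∷ z₂ ∷ []) (f z₁ ∷ f z₂ ∷ g z₁ ∷ g z₂ ∷ [])) i₁ i₂
  comparable-on-clique-side cl {f = f} {g} {z₁} {z₂} D≢D' compD compD' clique choice z₁∈Z z₂∈Z z₁≢z₂
                            i₁i₂ i₁z₂ i₂z₂ i₁sees i₂sees =
    Comparable-mono (λ v (complete , anti) →
        complete _ (there (here refl)) , anti _ (here refl) , anti _ (there (there (here refl))))
      (comparable-on-seesAvoiding cl (choice-partner-edge choice z₁∈Z) z₂≁fz₁ z₂≁gz₁
                                  i₁i₂ i₁z₂ i₂z₂ i₁sees i₂sees)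
    where
    z₂≁fz₁ : ¬ Edge G z₂ (f z₁)
    z₂≁fz₁ e = choice-private choice z₁∈Z (z₂ , z₂∈Z , ≢-sym z₁≢z₂ , e)
    z₂≁gz₁ : ¬ Edge G z₂ (g z₁)
    z₂≁gz₁ = components-nonadjacent D≢D' compD compD' (proj₁ clique _ z₂∈Z) (partner-∈ choice z₁∈Z)

module _ {n : ℕ} {P : Fin n → Set} {D : Subset n} {p q r : Fin n} where

  witness-off-head : ∃[ v ] (v ∈ₗ p ∷ q ∷ r ∷ [] × v ∉ D × P v) → p ∈ D → P q ⊎ P r
  witness-off-head (_ , here refl , p∉D , _) p∈D                = ⊥-elim (p∉D p∈D)
  witness-off-head (_ , there (here refl) , _ , Pq) _           = inj₁ Pq
  witness-off-head (_ , there (there (here refl)) , _ , Pr) _   = inj₂ Pr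

  witness-off-middle : ∃[ v ] (v ∈ₗ p ∷ q ∷ r ∷ [] × v ∉ D × P v) → q ∈ D → P p ⊎ P r
  witness-off-middle (_ , here refl , _ , Pp) _                 = inj₁ Pp
  witness-off-middle (_ , there (here refl) , q∉D , _) q∈D      = ⊥-elim (q∉D q∈D)
  witness-off-middle (_ , there (there (here refl)) , _ , Pr) _ = inj₂ Pr

module AmbiguousProfiles {n : ℕ} (G : Graph n) {S L R : Subset n} (L≢R : L ≢ R)
  (compL : IsComponent G S L) (compR : IsComponent G S R)
  {Z Z' : Subset n} (cliqueZ : GoodClique G S L Z) (cliqueZ' : GoodClique G S R Z')
  {f g : Fin n → Fin n} (choiceZ : GoodChoice G S R Z f g) (choiceZ' : GoodChoice G S L Z' f g)
  {a₁ a₂ d₁ d₂ : Fin n} (a₁∈Z : a₁ ∈ Z) (a₂∈Z : a₂ ∈ Z) (d₁∈Z' : d₁ ∈ Z') (d₂∈Z' : d₂ ∈ Z') where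

  W : List (Fin n)
  W = a₁ ∷ a₂ ∷ f a₁ ∷ f a₂ ∷ g a₁ ∷ g a₂ ∷ f d₁ ∷ f d₂ ∷ d₁ ∷ d₂ ∷ g d₁ ∷ g d₂ ∷ []

  triples : List (List (Fin n))
  triples = (a₁ ∷ f a₁ ∷ g a₁ ∷ []) ∷ (a₂ ∷ f a₂ ∷ g a₂ ∷ []) ∷
            (f d₁ ∷ d₁ ∷ g d₁ ∷ []) ∷ (f d₂ ∷ d₂ ∷ g d₂ ∷ []) ∷ []

  Lset Rset : List (Fin n)
  Lset = a₁ ∷ a₂ ∷ f a₁ ∷ f a₂ ∷ f d₁ ∷ f d₂ ∷ g d₁ ∷ g d₂ ∷ []
  Rset = f a₁ ∷ f a₂ ∷ f d₁ ∷ f d₂ ∷ d₁ ∷ d₂ ∷ g a₁ ∷ g a₂ ∷ []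

  L∌R : ∀ {v} → v ∈ L → v ∉ R
  L∌R = components-disjoint G L≢R compL compR

  R∌L : ∀ {v} → v ∈ R → v ∉ L
  R∌L = components-disjoint G (≢-sym L≢R) compR compL

  S∌R : ∀ {v} → v ∈ S → v ∉ R
  S∌R v∈S v∈R = proj₁ (proj₂ compR) _ v∈R v∈S

  S∌L : ∀ {v} → v ∈ S → v ∉ L
  S∌L v∈S v∈L = proj₁ (proj₂ compL) _ v∈L v∈S

  Z⊆L : ∀ {z} → z ∈ Z → z ∈ L
  Z⊆L = proj₁ cliqueZ _

  Z'⊆R : ∀ {z} → z ∈ Z' → z ∈ R
  Z'⊆R = proj₁ cliqueZ' _

  Lset∌R : All (_∉ R) Lset
  Lset∌R = L∌R (Z⊆L a₁∈Z) ∷ L∌R (Z⊆L a₂∈Z)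
         ∷ S∌R (choice-∈S G choiceZ a₁∈Z) ∷ S∌R (choice-∈S G choiceZ a₂∈Z)
         ∷ S∌R (choice-∈S G choiceZ' d₁∈Z') ∷ S∌R (choice-∈S G choiceZ' d₂∈Z')
         ∷ L∌R (partner-∈ G choiceZ' d₁∈Z') ∷ L∌R (partner-∈ G choiceZ' d₂∈Z') ∷ []

  Rset∌L : All (_∉ L) Rset
  Rset∌L = S∌L (choice-∈S G choiceZ a₁∈Z) ∷ S∌L (choice-∈S G choiceZ a₂∈Z)
         ∷ S∌L (choice-∈S G choiceZ' d₁∈Z') ∷ S∌L (choice-∈S G choiceZ' d₂∈Z')
         ∷ R∌L (Z'⊆R d₁∈Z') ∷ R∌L (Z'⊆R d₂∈Z')
         ∷ R∌L (partner-∈ G choiceZ a₁∈Z) ∷ R∌L (partner-∈ G choiceZ a₂∈Z) ∷ []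

  module _ {i : Fin n} (amb : AmbiguousProfile G W triples Lset (NbhdIn G W i)) where

    L-ambiguous-misses-d₂ : ¬ Edge G i d₂
    L-ambiguous-misses-d₂ = ambiguous-misses G amb Lset∌R d₂∈W (Z'⊆R d₂∈Z')
      where
      d₂∈W : d₂ ∈ₗ W
      d₂∈W = there (there (there (there (there (there (there (there (there (here refl)))))))))

    L-ambiguous-sees-c₁-or-l₁ : Edge G i (f d₁) ⊎ Edge G i (g d₁)
    L-ambiguous-sees-c₁-or-l₁ =
      witness-off-middle (ambiguous-meets-outside G amb Lset∌R (there (there (here refl)))) (Z'⊆R d₁∈Z')

  module _ {i : Fin n} (amb : AmbiguousProfile G W triples Rset (NbhdIn G W i)) where

    R-ambiguous-misses-a₂ : ¬ Edge G i a₂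
    R-ambiguous-misses-a₂ = ambiguous-misses G amb Rset∌L (there (here refl)) (Z⊆L a₂∈Z)

    R-ambiguous-sees-b₁-or-r₁ : Edge G i (f a₁) ⊎ Edge G i (g a₁)
    R-ambiguous-sees-b₁-or-r₁ =
      witness-off-head (ambiguous-meets-outside G amb Rset∌L (here refl)) (Z⊆L a₁∈Z)

lemma3p6 : {n : ℕ} (G : Graph n) → InClassC G →
    (S L R : Subset n) → L ≢ R → IsFullComponent G S L → IsFullComponent G S R →
    (Z Z' : Subset n) → GoodClique G S L Z → GoodClique G S R Z' →
    (f g : Fin n → Fin n) → GoodChoice G S R Z f g → GoodChoice G S L Z' f g →
    (a₁ a₂ d₁ d₂ : Fin n) → a₁ ∈ Z → a₂ ∈ Z → a₁ ≢ a₂ → d₁ ∈ Z' → d₂ ∈ Z' → d₁ ≢ d₂ →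
    let b₁ = f a₁
        b₂ = f a₂
        r₁ = g a₁
        r₂ = g a₂
        c₁ = f d₁
        c₂ = f d₂
        l₁ = g d₁
        l₂ = g d₂
        W = a₁ ∷ a₂ ∷ b₁ ∷ b₂ ∷ r₁ ∷ r₂ ∷ c₁ ∷ c₂ ∷ d₁ ∷ d₂ ∷ l₁ ∷ l₂ ∷ []
        triples = (a₁ ∷ b₁ ∷ r₁ ∷ []) ∷ (a₂ ∷ b₂ ∷ r₂ ∷ []) ∷
                  (c₁ ∷ d₁ ∷ l₁ ∷ []) ∷ (c₂ ∷ d₂ ∷ l₂ ∷ []) ∷ []
        Lset = a₁ ∷ a₂ ∷ b₁ ∷ b₂ ∷ c₁ ∷ c₂ ∷ l₁ ∷ l₂ ∷ []
        Rset = b₁ ∷ b₂ ∷ c₁ ∷ c₂ ∷ d₁ ∷ d₂ ∷ r₁ ∷ r₂ ∷ []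
        ZR = CompleteAnti G (d₁ ∷ d₂ ∷ []) (c₁ ∷ c₂ ∷ l₁ ∷ l₂ ∷ [])
        ZL = CompleteAnti G (a₁ ∷ a₂ ∷ []) (b₁ ∷ b₂ ∷ r₁ ∷ r₂ ∷ [])
    in (I : Subset n) → IsIndependent G I →
       ((i₁ i₂ : Fin n) → i₁ ∈ I → i₂ ∈ I →
          AmbiguousProfile G W triples Lset (NbhdIn G W i₁) →
          AmbiguousProfile G W triples Lset (NbhdIn G W i₂) →
          Comparable G ZR i₁ i₂)
     × ((i₁ i₂ : Fin n) → i₁ ∈ I → i₂ ∈ I →
          AmbiguousProfile G W triples Rset (NbhdIn G W i₁) →
          AmbiguousProfile G W triples Rset (NbhdIn G W i₂) →
          Comparable G ZL i₁ i₂)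
lemma3p6 G cl S L R L≢R (compL , _) (compR , _) Z Z' cliqueZ cliqueZ' f g choiceZ choiceZ'
         a₁ a₂ d₁ d₂ a₁∈Z a₂∈Z a₁≢a₂ d₁∈Z' d₂∈Z' d₁≢d₂ I independent =
    (λ i₁ i₂ i₁∈I i₂∈I amb₁ amb₂ →
       comparable-on-clique-side G cl (≢-sym L≢R) compR compL cliqueZ' choiceZ' d₁∈Z' d₂∈Z' d₁≢d₂
         (independent i₁ i₂ i₁∈I i₂∈I)
         (L-ambiguous-misses-d₂ amb₁) (L-ambiguous-misses-d₂ amb₂)
         (L-ambiguous-sees-c₁-or-l₁ amb₁) (L-ambiguous-sees-c₁-or-l₁ amb₂))
  , (λ i₁ i₂ i₁∈I i₂∈I amb₁ amb₂ →
       comparable-on-clique-side G cl L≢R compL compR cliqueZ choiceZ a₁∈Z a₂∈Z a₁≢a₂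
         (independent i₁ i₂ i₁∈I i₂∈I)
         (R-ambiguous-misses-a₂ amb₁) (R-ambiguous-misses-a₂ amb₂)
         (R-ambiguous-sees-b₁-or-r₁ amb₁) (R-ambiguous-sees-b₁-or-r₁ amb₂))
  where
  open AmbiguousProfiles G L≢R compL compR cliqueZ cliqueZ' choiceZ choiceZ' a₁∈Z a₂∈Z d₁∈Z' d₂∈Z'
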